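{- Let $s\geq 3$ and $n\geq 4s+3$ be integers with $\gcd(n,s)=1$. The circulant graph $\mathrm{circ}(n;\pm1,\pm s)$ is $3$-spanning cyclable.
   Context: $\mathrm{circ}(n;\pm1,\pm s)$ is the Cayley graph on $\mathbb{Z}/n\mathbb{Z}$ with connection set $\{\pm1,\pm s\}$: vertices $u_0,\dots,u_{n-1}$ (indices mod $n$), with $u_i$ adjacent to $u_{i\pm1}$ and $u_{i\pm s}$. A 2-factor of a graph is a spanning subgraph in which every vertex has valency 2; it separates a set $A$ of $k$ vertices if it consists of exactly $k$ cycles and $A$ meets the vertex set of each cycle in exactly one vertex. A graph $X$ is $k$-spanning cyclable if for every $A\subseteq V(X)$ with $|A|=k$ there is a 2-factor of $X$ separating $A$. -}

module Defs where

open import Data.Nat using (ℕ; zero; suc; _+_; _≤_; NonZero)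
open import Data.Nat.DivMod using (_%_)
open import Data.Fin using (Fin; toℕ)
open import Data.Fin.Subset using (Subset; _∈_; ∣_∣)
open import Data.Product using (Σ; ∃; ∃-syntax; _×_; _,_)
open import Data.Sum using (_⊎_)
open import Relation.Binary.PropositionalEquality using (_≡_)

Graph : ℕ → Set₁
Graph n = Fin n → Fin n → Set

circ : (n s : ℕ) → .{{_ : NonZero n}} → Graph n
circ n s i j =
  ((toℕ i + 1) % n ≡ toℕ j) ⊎ ((toℕ j + 1) % n ≡ toℕ i) ⊎
  ((toℕ i + s) % n ≡ toℕ j) ⊎ ((toℕ j + s) % n ≡ toℕ i)

CycSucc : {m : ℕ} → Fin m → Fin m → Set
CycSucc {m} i j = (toℕ j ≡ toℕ i + 1) ⊎ ((toℕ i + 1 ≡ m) × (toℕ j ≡ 0))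

-- A cycle of G: a closed walk c_0 c_1 … c_{m-1} c_0 of length m ≥ 3
-- (so that it is a cycle in a simple graph) with pairwise distinct
-- vertices; distinctness is imposed globally in TwoFactor below.
record Cycle {n : ℕ} (G : Graph n) : Set where
  field
    len    : ℕ
    len≥3  : 3 ≤ len
    vert   : Fin len → Fin n
    edge   : (i j : Fin len) → CycSucc i j → G (vert i) (vert j)
open Cycle public

-- A 2-factor of G consisting of exactly k cycles: a family of k
-- vertex-disjoint cycles of G that together cover every vertex exactly once
-- (equivalently, a spanning 2-regular subgraph with exactly k components).
record TwoFactor {n : ℕ} (G : Graph n) (k : ℕ) : Set where
  field
    cyc    : Fin k → Cycle G
    cover  : (v : Fin n) → ∃[ j ] ∃[ i ] vert (cyc j) i ≡ v
    -- and at exactly one position (cycles are disjoint and simple)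
    unique : (j j′ : Fin k) (i : Fin (len (cyc j))) (i′ : Fin (len (cyc j′))) →
             vert (cyc j) i ≡ vert (cyc j′) i′ →
             Σ (j ≡ j′) λ { _≡_.refl → i ≡ i′ }
open TwoFactor public

Separates : {n k : ℕ} {G : Graph n} → TwoFactor G k → Subset n → Set
Separates {k = k} F A =
  (j : Fin k) →
    (∃[ i ] vert (cyc F j) i ∈ A) ×
    ((i i′ : Fin (len (cyc F j))) →
      vert (cyc F j) i ∈ A → vert (cyc F j) i′ ∈ A → i ≡ i′)

SpanningCyclable : {n : ℕ} → ℕ → Graph n → Set
SpanningCyclable {n} k G =
  (A : Subset n) → ∣ A ∣ ≡ k → Σ (TwoFactor G k) λ F → Separates F A

-- Translations u_i ↦ u_{i+x} are automorphisms of circ(n; ±1, ±s). When s + 3 ≤ d and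
-- d + s + 3 ≤ n the graph has the 2-factor made of the 4-cycles on {0, 1, s, s+1} and
-- {d, d+1, d+s, d+s+1} and one long cycle through all other vertices (down from s-1 to 2,
-- a jump by s, up to d-1, a jump by s, and the same in the block starting at d). So it
-- suffices to choose d and a translation putting the three vertices of A on the three cycles.
-- List A in cyclic order with gaps u, v, g, so u + v + g = n ≥ 4s + 3: some gap is at least
-- s + 3 unless s = 3 and all gaps are 5. Rotating so that g ≥ s + 3, a short case analysis on
-- u and v (is u + v ≤ s + 2, is v ≥ s + 2, is u equal to s or s + 1?) gives the placement.

module Submission where

open import Defs
open import Data.Nat using (ℕ; zero; suc; _+_; _*_; _∸_; _≤_; _<_; NonZero; s≤s; z≤n; s≤s⁻¹)
open import Data.Nat.Properties
open import Data.Nat.DivMod using (_%_; m%n<n; m%n≤n; m%n%n≡m%n; %-distribˡ-+; [m+n]%n≡m%n; m<n⇒m%n≡m)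
open import Data.Nat.GCD using (gcd)
open import Data.Nat.Tactic.RingSolver using (solve-∀)
open import Algebra.Properties.CommutativeSemigroup +-commutativeSemigroup using (x∙yz≈y∙xz)
open import Data.Fin using (Fin; toℕ; fromℕ<) renaming (zero to fz; suc to fs)
open import Data.Fin.Properties using (toℕ-fromℕ<; toℕ-injective; toℕ<n)
open import Data.Fin.Subset using (Subset; _∈_; ∣_∣; inside; outside)
open import Data.Vec.Base using ([]; _∷_; here; there)
open import Data.Product using (Σ; ∃-syntax; _×_; _,_; proj₁; proj₂)
open import Data.Sum using (_⊎_; inj₁; inj₂; [_,_]′)
open import Function using (_∘_; case_of_)
open import Relation.Nullary using (¬_; yes; no; contradiction)
open import Relation.Binary.Definitions using (tri<; tri≈; tri>)
open import Relation.Binary.PropositionalEquality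

Separable : ∀ {n} → Graph n → ℕ → Subset n → Set
Separable G k A = Σ (TwoFactor G k) (λ F → Separates F A)

-- Offsets whose vertices u_{x+o}, u_{x+o′} are adjacent for every x; only jumpAround wraps
-- around modulo n.
data Adjacent (n s o o′ : ℕ) : Set where
  next       : o + 1 ≡ o′ → Adjacent n s o o′
  prev       : o′ + 1 ≡ o → Adjacent n s o o′
  jump       : o + s ≡ o′ → Adjacent n s o o′
  jumpBack   : o′ + s ≡ o → Adjacent n s o o′
  jumpAround : o + s ≡ o′ + n → Adjacent n s o o′

+-shiftˡ : ∀ c {a b d} → a + d ≡ b → c + a + d ≡ c + b
+-shiftˡ c {a} {d = d} e = trans (+-assoc c a d) (cong (c +_) e)

Adjacent-+ : ∀ {n s o o′} c → Adjacent n s o o′ → Adjacent n s (c + o) (c + o′)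
Adjacent-+ c (next e)     = next (+-shiftˡ c e)
Adjacent-+ c (prev e)     = prev (+-shiftˡ c e)
Adjacent-+ c (jump e)     = jump (+-shiftˡ c e)
Adjacent-+ c (jumpBack e) = jumpBack (+-shiftˡ c e)
Adjacent-+ {n} {o′ = o′} c (jumpAround e) = jumpAround (trans (+-shiftˡ c e) (sym (+-assoc c o′ n)))

module Translation (n : ℕ) .{{_ : NonZero n}} where
  open ≡-Reasoning

  vertexAt : ℕ → ℕ → Fin n
  vertexAt x o = fromℕ< (m%n<n (x + o) n)

  toℕ-vertexAt : ∀ x o → toℕ (vertexAt x o) ≡ (x + o) % n
  toℕ-vertexAt x o = toℕ-fromℕ< (m%n<n (x + o) n)

  vertexAt-% : ∀ x o (v : Fin n) → (x + o) % n ≡ toℕ v → vertexAt x o ≡ v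
  vertexAt-% x o v e = toℕ-injective (trans (toℕ-vertexAt x o) e)

  vertexAt-≡ : ∀ x o (v : Fin n) → x + o ≡ toℕ v → vertexAt x o ≡ v
  vertexAt-≡ x o v e = vertexAt-% x o v (trans (cong (_% n) e) (m<n⇒m%n≡m (toℕ<n v)))

  vertexAt-≡+n : ∀ x o (v : Fin n) → x + o ≡ toℕ v + n → vertexAt x o ≡ v
  vertexAt-≡+n x o v e = vertexAt-% x o v (begin
    (x + o) % n        ≡⟨ cong (_% n) e ⟩
    (toℕ v + n) % n    ≡⟨ [m+n]%n≡m%n (toℕ v) n ⟩
    toℕ v % n          ≡⟨ m<n⇒m%n≡m (toℕ<n v) ⟩
    toℕ v              ∎)

  [m%n+k]%n≡[m+k]%n : ∀ m k → (m % n + k) % n ≡ (m + k) % n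
  [m%n+k]%n≡[m+k]%n m k = begin
    (m % n + k) % n         ≡⟨ %-distribˡ-+ (m % n) k n ⟩
    (m % n % n + k % n) % n ≡⟨ cong (λ r → (r + k % n) % n) (m%n%n≡m%n m n) ⟩
    (m % n + k % n) % n     ≡⟨ %-distribˡ-+ m k n ⟨
    (m + k) % n             ∎

  vertexAt-vertexAt : ∀ x a b → vertexAt (toℕ (vertexAt x a)) b ≡ vertexAt x (a + b)
  vertexAt-vertexAt x a b = toℕ-injective (begin
    toℕ (vertexAt (toℕ (vertexAt x a)) b) ≡⟨ toℕ-vertexAt _ b ⟩
    (toℕ (vertexAt x a) + b) % n          ≡⟨ cong (λ r → (r + b) % n) (toℕ-vertexAt x a) ⟩
    ((x + a) % n + b) % n                 ≡⟨ [m%n+k]%n≡[m+k]%n (x + a) b ⟩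
    (x + a + b) % n                       ≡⟨ cong (_% n) (+-assoc x a b) ⟩
    (x + (a + b)) % n                     ≡⟨ toℕ-vertexAt x (a + b) ⟨
    toℕ (vertexAt x (a + b))              ∎)

  vertexAt-shift : ∀ x {α} o → α ≤ n → vertexAt (x + (n ∸ α)) (α + o) ≡ vertexAt x o
  vertexAt-shift x {α} o α≤n = toℕ-injective (begin
    toℕ (vertexAt (x + (n ∸ α)) (α + o)) ≡⟨ toℕ-vertexAt (x + (n ∸ α)) (α + o) ⟩
    (x + (n ∸ α) + (α + o)) % n          ≡⟨ cong (_% n) (shuffle x (n ∸ α) α o) ⟩
    (x + o + (n ∸ α + α)) % n            ≡⟨ cong (λ r → (x + o + r) % n) (m∸n+n≡m α≤n) ⟩
    (x + o + n) % n                      ≡⟨ [m+n]%n≡m%n (x + o) n ⟩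
    (x + o) % n                          ≡⟨ toℕ-vertexAt x o ⟨
    toℕ (vertexAt x o)                   ∎)
    where
    shuffle : ∀ a b c d → a + b + (c + d) ≡ a + d + (b + c)
    shuffle = solve-∀

  offsetOf : ℕ → ℕ → ℕ
  offsetOf x v = (v + (n ∸ x % n)) % n

  [x+w+n∸x%n]%n≡w%n : ∀ x w → (x + w + (n ∸ x % n)) % n ≡ w % n
  [x+w+n∸x%n]%n≡w%n x w = begin
    (x + w + (n ∸ x % n)) % n       ≡⟨ cong (_% n) (+-assoc x w _) ⟩
    (x + (w + (n ∸ x % n))) % n     ≡⟨ [m%n+k]%n≡[m+k]%n x _ ⟨
    (x % n + (w + (n ∸ x % n))) % n ≡⟨ cong (_% n) (x∙yz≈y∙xz (x % n) w _) ⟩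
    (w + (x % n + (n ∸ x % n))) % n ≡⟨ cong (λ r → (w + r) % n) (m+[n∸m]≡n (m%n≤n x n)) ⟩
    (w + n) % n                     ≡⟨ [m+n]%n≡m%n w n ⟩
    w % n                           ∎

  offsetOf-vertexAt : ∀ x {o} → o < n → offsetOf x (toℕ (vertexAt x o)) ≡ o
  offsetOf-vertexAt x {o} o<n = begin
    (toℕ (vertexAt x o) + (n ∸ x % n)) % n ≡⟨ cong (λ r → (r + (n ∸ x % n)) % n) (toℕ-vertexAt x o) ⟩
    ((x + o) % n + (n ∸ x % n)) % n        ≡⟨ [m%n+k]%n≡[m+k]%n (x + o) _ ⟩
    (x + o + (n ∸ x % n)) % n              ≡⟨ [x+w+n∸x%n]%n≡w%n x o ⟩
    o % n                                  ≡⟨ m<n⇒m%n≡m o<n ⟩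
    o                                      ∎

  vertexAt-injective : ∀ x {o o′} → o < n → o′ < n → vertexAt x o ≡ vertexAt x o′ → o ≡ o′
  vertexAt-injective x {o} {o′} o<n o′<n same = begin
    o                                ≡⟨ offsetOf-vertexAt x o<n ⟨
    offsetOf x (toℕ (vertexAt x o))  ≡⟨ cong (offsetOf x ∘ toℕ) same ⟩
    offsetOf x (toℕ (vertexAt x o′)) ≡⟨ offsetOf-vertexAt x o′<n ⟩
    o′                               ∎

  vertexAt-offsetOf : ∀ x (v : Fin n) → vertexAt x (offsetOf x (toℕ v)) ≡ v
  vertexAt-offsetOf x v = toℕ-injective (begin
    toℕ (vertexAt x (offsetOf x (toℕ v)))    ≡⟨ toℕ-vertexAt x _ ⟩
    (x + (toℕ v + (n ∸ x % n)) % n) % n      ≡⟨ cong (_% n) (+-comm x _) ⟩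
    ((toℕ v + (n ∸ x % n)) % n + x) % n      ≡⟨ [m%n+k]%n≡[m+k]%n _ x ⟩
    (toℕ v + (n ∸ x % n) + x) % n            ≡⟨ cong (_% n) (shuffle (toℕ v) _ x) ⟩
    (x + toℕ v + (n ∸ x % n)) % n            ≡⟨ [x+w+n∸x%n]%n≡w%n x (toℕ v) ⟩
    toℕ v % n                                ≡⟨ m<n⇒m%n≡m (toℕ<n v) ⟩
    toℕ v                                    ∎)
    where
    shuffle : ∀ a b c → a + b + c ≡ c + a + b
    shuffle = solve-∀

  offsetOf<n : ∀ x v → offsetOf x v < n
  offsetOf<n x v = m%n<n _ n

  circ-vertexAt : ∀ {s o o′} x → Adjacent n s o o′ → circ n s (vertexAt x o) (vertexAt x o′)
  circ-vertexAt {s} {o} {o′} x adj rewrite toℕ-vertexAt x o | toℕ-vertexAt x o′ = circ-offsets adj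
    where
    shifted : ∀ {a b} c → a + c ≡ b → ((x + a) % n + c) % n ≡ (x + b) % n
    shifted {a} c e = trans ([m%n+k]%n≡[m+k]%n (x + a) c) (cong (_% n) (+-shiftˡ x e))
    circ-offsets : Adjacent n s o o′ →
      (((x + o) % n + 1) % n ≡ (x + o′) % n) ⊎ (((x + o′) % n + 1) % n ≡ (x + o) % n) ⊎
      (((x + o) % n + s) % n ≡ (x + o′) % n) ⊎ (((x + o′) % n + s) % n ≡ (x + o) % n)
    circ-offsets (next e)       = inj₁ (shifted 1 e)
    circ-offsets (prev e)       = inj₂ (inj₁ (shifted 1 e))
    circ-offsets (jump e)       = inj₂ (inj₂ (inj₁ (shifted s e)))
    circ-offsets (jumpBack e)   = inj₂ (inj₂ (inj₂ (shifted s e)))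
    circ-offsets (jumpAround e) = inj₂ (inj₂ (inj₁ (begin
      ((x + o) % n + s) % n ≡⟨ shifted s e ⟩
      (x + (o′ + n)) % n    ≡⟨ cong (_% n) (+-assoc x o′ n) ⟨
      (x + o′ + n) % n      ≡⟨ [m+n]%n≡m%n (x + o′) n ⟩
      (x + o′) % n          ∎)))

  record ExactlyAt {k} (A : Subset n) (x : ℕ) (o : Fin k → ℕ) : Set where
    field
      at∈A  : ∀ j → vertexAt x (o j) ∈ A
      ∈A⇒at : ∀ v → v ∈ A → ∃[ j ] v ≡ vertexAt x (o j)

Σ-≡-toℕ : ∀ {k} {m : Fin k → ℕ} {j j′} {i : Fin (m j)} {i′ : Fin (m j′)} →
          (j , toℕ i) ≡ (j′ , toℕ i′) → _≡_ {A = Σ (Fin k) (Fin ∘ m)} (j , i) (j′ , i′)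
Σ-≡-toℕ eq with cong proj₁ eq
... | refl = cong (_ ,_) (toℕ-injective (cong proj₂ eq))

separates-by-representatives :
  ∀ {n k} {G : Graph n} (F : TwoFactor G k) (A : Subset n) (rep : (j : Fin k) → Fin (len (cyc F j))) →
  (∀ j → vert (cyc F j) (rep j) ∈ A) →
  (∀ v → v ∈ A → ∃[ j ] v ≡ vert (cyc F j) (rep j)) →
  Separates F A
separates-by-representatives F A rep rep∈A ∈A⇒rep j = (rep j , rep∈A j) , λ i i′ i∈A i′∈A →
  trans (is-rep i i∈A) (sym (is-rep i′ i′∈A))
  where
  is-rep : ∀ {j} (i : Fin (len (cyc F j))) → vert (cyc F j) i ∈ A → i ≡ rep j
  is-rep {j} i i∈A with ∈A⇒rep _ i∈A
  ... | j′ , same with unique F j j′ i (rep j′) same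
  ...   | refl , i≡rep = i≡rep

record OffsetLayout (n s k : ℕ) : Set where
  field
    length     : Fin k → ℕ
    3≤length   : ∀ j → 3 ≤ length j
    offset     : Fin k → ℕ → ℕ
    offset<n   : ∀ j i → i < length j → offset j i < n
    adjacent   : ∀ j i → suc i < length j → Adjacent n s (offset j i) (offset j (suc i))
    closing    : ∀ j → Adjacent n s (offset j (length j ∸ 1)) (offset j 0)
    locate     : ℕ → Fin k × ℕ
    locate-offset     : ∀ j i → i < length j → locate (offset j i) ≡ (j , i)
    offset-surjective : ∀ o → o < n → ∃[ j ] ∃[ i ] i < length j × offset j i ≡ o

  OnCycle : Fin k → ℕ → Set
  OnCycle j o = ∃[ i ] i < length j × offset j i ≡ o

module _ {n s k : ℕ} .{{_ : NonZero n}} (L : OffsetLayout n s k) (x : ℕ) where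
  open OffsetLayout L
  open Translation n

  cycleAt : Fin k → Cycle (circ n s)
  cycleAt j = record
    { len = length j ; len≥3 = 3≤length j ; vert = λ i → vertexAt x (offset j (toℕ i)) ; edge = edge-at }
    where
    edge-at : (i i′ : Fin (length j)) → CycSucc i i′ →
              circ n s (vertexAt x (offset j (toℕ i))) (vertexAt x (offset j (toℕ i′)))
    edge-at i i′ (inj₁ i′≡i+1) = subst (λ r → circ n s _ (vertexAt x (offset j r))) (sym i′≡1+i)
      (circ-vertexAt x (adjacent j (toℕ i) (subst (_< length j) i′≡1+i (toℕ<n i′))))
      where
      i′≡1+i : toℕ i′ ≡ suc (toℕ i)
      i′≡1+i = trans i′≡i+1 (+-comm (toℕ i) 1)
    edge-at i i′ (inj₂ (i+1≡len , i′≡0)) =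
      subst₂ (λ r r′ → circ n s (vertexAt x (offset j r)) (vertexAt x (offset j r′)))
             (sym i≡len∸1) (sym i′≡0) (circ-vertexAt x (closing j))
      where
      i≡len∸1 : toℕ i ≡ length j ∸ 1
      i≡len∸1 = trans (sym (m+n∸n≡m (toℕ i) 1)) (cong (_∸ 1) i+1≡len)

  position-injective : ∀ {j j′} (i : Fin (length j)) (i′ : Fin (length j′)) →
    vertexAt x (offset j (toℕ i)) ≡ vertexAt x (offset j′ (toℕ i′)) →
    _≡_ {A = Σ (Fin k) (Fin ∘ length)} (j , i) (j′ , i′)
  position-injective {j} {j′} i i′ same = Σ-≡-toℕ (begin
    (j , toℕ i)                 ≡⟨ locate-offset j (toℕ i) (toℕ<n i) ⟨
    locate (offset j (toℕ i))   ≡⟨ cong locate offsets-≡ ⟩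
    locate (offset j′ (toℕ i′)) ≡⟨ locate-offset j′ (toℕ i′) (toℕ<n i′) ⟩
    (j′ , toℕ i′)               ∎)
    where
    open ≡-Reasoning
    offsets-≡ : offset j (toℕ i) ≡ offset j′ (toℕ i′)
    offsets-≡ = vertexAt-injective x (offset<n j _ (toℕ<n i)) (offset<n j′ _ (toℕ<n i′)) same

  indexOf : ∀ {j o} → OnCycle j o → Fin (length j)
  indexOf (_ , i<length , _) = fromℕ< i<length

  vertexAt-indexOf : ∀ {j o} (on : OnCycle j o) → vertexAt x (offset j (toℕ (indexOf on))) ≡ vertexAt x o
  vertexAt-indexOf (i , i<length , refl) = cong (vertexAt x ∘ offset _) (toℕ-fromℕ< i<length)

  twoFactor : TwoFactor (circ n s) k
  twoFactor = record
    { cyc    = cycleAt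
    ; cover  = λ v → let (j , on) = offset-surjective _ (offsetOf<n x (toℕ v)) in
                     j , indexOf on , trans (vertexAt-indexOf on) (vertexAt-offsetOf x v)
    ; unique = λ j j′ i i′ same → case position-injective i i′ same of λ { refl → refl , refl }
    }

  twoFactor-separates : (A : Subset n) (o : Fin k → ℕ) → (∀ j → OnCycle j (o j)) → ExactlyAt A x o →
                        Separates twoFactor A
  twoFactor-separates A o on at = separates-by-representatives twoFactor A (indexOf ∘ on)
    (λ j → subst (_∈ A) (sym (vertexAt-indexOf (on j))) (at∈A j))
    (λ v v∈A → let (j , v≡) = ∈A⇒at v v∈A in j , trans v≡ (sym (vertexAt-indexOf (on j))))
    where open ExactlyAt at

-- A block of offsets 0 … ℓ-1, where s = 2 + t and ℓ ≥ s + 3: the 4-cycle square visits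
-- 0, 1, s+1, s and the path visits s-1, s-2, …, 2, s+2, s+3, …, ℓ-1. position o is inj₁ i
-- when o = square i and inj₂ i when o = path i.
module Block (t : ℕ) where

  square : ℕ → ℕ
  square 0 = 0
  square 1 = 1
  square 2 = 3 + t
  square _ = 2 + t

  path : ℕ → ℕ
  path i with i <? t
  ... | yes _ = (1 + t) ∸ i
  ... | no _  = 4 + i

  path-< : ∀ {i} → i < t → path i ≡ (1 + t) ∸ i
  path-< {i} i<t with i <? t
  ... | yes _   = refl
  ... | no i≮t = contradiction i<t i≮t

  path-≥ : ∀ {i} → t ≤ i → path i ≡ 4 + i
  path-≥ {i} t≤i with i <? t
  ... | yes i<t = contradiction t≤i (<⇒≱ i<t)
  ... | no _    = refl

  position : ℕ → ℕ ⊎ ℕ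
  position o with o <? 2
  ... | yes _ = inj₁ o
  ... | no _ with o <? 2 + t
  ...   | yes _ = inj₂ ((1 + t) ∸ o)
  ...   | no _ with o <? 4 + t
  ...     | yes _ = inj₁ ((5 + t) ∸ o)
  ...     | no _  = inj₂ (o ∸ 4)

  position-descending : ∀ {o} → 2 ≤ o → o < 2 + t → position o ≡ inj₂ ((1 + t) ∸ o)
  position-descending {o} 2≤o o<2+t with o <? 2
  ... | yes o<2 = contradiction 2≤o (<⇒≱ o<2)
  ... | no _ with o <? 2 + t
  ...   | yes _ = refl
  ...   | no o≮2+t = contradiction o<2+t o≮2+t

  position-middle : ∀ {o} → 2 + t ≤ o → o < 4 + t → position o ≡ inj₁ ((5 + t) ∸ o)
  position-middle {o} 2+t≤o o<4+t with o <? 2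
  ... | yes o<2 = contradiction (≤-trans (m≤m+n 2 t) 2+t≤o) (<⇒≱ o<2)
  ... | no _ with o <? 2 + t
  ...   | yes o<2+t = contradiction 2+t≤o (<⇒≱ o<2+t)
  ...   | no _ with o <? 4 + t
  ...     | yes _ = refl
  ...     | no o≮4+t = contradiction o<4+t o≮4+t

  position-ascending : ∀ {o} → 4 + t ≤ o → position o ≡ inj₂ (o ∸ 4)
  position-ascending {o} 4+t≤o with o <? 2
  ... | yes o<2 = contradiction (≤-trans (m≤m+n 4 t) 4+t≤o) (<⇒≱ (≤-trans o<2 (m≤m+n 2 2)))
  ... | no _ with o <? 2 + t
  ...   | yes o<2+t = contradiction 4+t≤o (<⇒≱ (≤-trans o<2+t (m≤n+m (2 + t) 2)))
  ...   | no _ with o <? 4 + t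
  ...     | yes o<4+t = contradiction 4+t≤o (<⇒≱ o<4+t)
  ...     | no _ = refl

  position-square : ∀ {i} → i < 4 → position (square i) ≡ inj₁ i
  position-square {0} _ = refl
  position-square {1} _ = refl
  position-square {2} _ = trans (position-middle (n≤1+n _) ≤-refl) (cong inj₁ (m+n∸n≡m 2 t))
  position-square {3} _ = trans (position-middle ≤-refl (n≤1+n _)) (cong inj₁ (m+n∸n≡m 3 t))
  position-square {suc (suc (suc (suc _)))} (s≤s (s≤s (s≤s (s≤s ()))))

  position-path : ∀ i → position (path i) ≡ inj₂ i
  position-path i with i <? t
  ... | yes i<t =
    trans (position-descending (m+n≤o⇒m≤o∸n 2 (s≤s i<t)) (s≤s (m∸n≤m (1 + t) i)))
          (cong inj₂ (m∸[m∸n]≡n (m≤n⇒m≤1+n (<⇒≤ i<t))))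
  ... | no i≮t = position-ascending (+-monoʳ-≤ 4 (≮⇒≥ i≮t))

  square<4+t : ∀ {i} → i < 4 → square i < 4 + t
  square<4+t {0} _ = s≤s z≤n
  square<4+t {1} _ = s≤s (s≤s z≤n)
  square<4+t {2} _ = ≤-refl
  square<4+t {3} _ = n≤1+n _
  square<4+t {suc (suc (suc (suc _)))} (s≤s (s≤s (s≤s (s≤s ()))))

  t<1+t+k : ∀ k → t < 1 + t + k
  t<1+t+k k = s≤s (m≤m+n t k)

  square-bound : ∀ k {i} → i < 4 → square i < 5 + t + k
  square-bound k i<4 = ≤-trans (square<4+t i<4) (≤-trans (n≤1+n (4 + t)) (m≤m+n (5 + t) k))

  path-bound : ∀ k {i} → i < 1 + t + k → path i < 5 + t + k
  path-bound k {i} i<1+t+k with i <? t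
  ... | yes _ = ≤-<-trans (m∸n≤m (1 + t) i) (≤-trans (m≤n+m (2 + t) 3) (m≤m+n (5 + t) k))
  ... | no _  = +-monoʳ-< 4 i<1+t+k

  square-adjacent : ∀ {n i} → i < 3 → Adjacent n (2 + t) (square i) (square (suc i))
  square-adjacent {i = 0} _ = next refl
  square-adjacent {i = 1} _ = jump refl
  square-adjacent {i = 2} _ = prev (+-comm (2 + t) 1)
  square-adjacent {i = suc (suc (suc _))} (s≤s (s≤s (s≤s ())))

  square-closing : ∀ {n} → Adjacent n (2 + t) (square 3) (square 0)
  square-closing = jumpBack refl

  path-adjacent : ∀ {n} i → Adjacent n (2 + t) (path i) (path (suc i))
  path-adjacent i with <-cmp (suc i) t
  ... | tri< 1+i<t _ _ rewrite path-< 1+i<t | path-< (<-trans (n<1+n i) 1+i<t) =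
    prev (trans (+-comm _ 1) (sym (+-∸-assoc 1 {1 + t} {suc i} (m≤n⇒m≤1+n (<⇒≤ 1+i<t)))))
  ... | tri≈ _ refl _ rewrite path-< (n<1+n i) | path-≥ (≤-refl {t}) =
    jump (cong (_+ (3 + i)) (m+n∸n≡m 2 i))
  ... | tri> _ _ t<1+i rewrite path-≥ (s≤s⁻¹ t<1+i) | path-≥ (m≤n⇒m≤1+n (s≤s⁻¹ t<1+i)) =
    next (cong (4 +_) (+-comm i 1))

  square-low : ∀ {o} → o < 2 → square o ≡ o
  square-low {0} _ = refl
  square-low {1} _ = refl
  square-low {suc (suc _)} (s≤s (s≤s ()))

  square-middle : ∀ {o} → 2 + t ≤ o → o < 4 + t → ∃[ i ] i < 4 × square i ≡ o
  square-middle {o} 2+t≤o o<4+t with m≤n⇒∃[o]m+o≡n 2+t≤o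
  ... | 0 , refl = 3 , ≤-refl , sym (+-identityʳ (2 + t))
  ... | 1 , refl = 2 , n≤1+n _ , sym (+-comm (2 + t) 1)
  ... | suc (suc r) , refl =
    contradiction o<4+t
      (≤⇒≯ (subst (_≤ 2 + t + suc (suc r)) (+-comm (2 + t) 2) (+-monoʳ-≤ (2 + t) (s≤s (s≤s z≤n)))))

  path-descending : ∀ {o} → 2 ≤ o → o < 2 + t → (1 + t) ∸ o < t × path ((1 + t) ∸ o) ≡ o
  path-descending {o} 2≤o o<2+t = below , trans (path-< below) (m∸[m∸n]≡n (s≤s⁻¹ o<2+t))
    where
    below : (1 + t) ∸ o < t
    below = ∸-monoʳ-< 2≤o (s≤s⁻¹ o<2+t)

  path-ascending : ∀ {o} → 4 + t ≤ o → path (o ∸ 4) ≡ o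
  path-ascending {o} 4+t≤o = trans (path-≥ (∸-monoˡ-≤ 4 4+t≤o)) (m+[n∸m]≡n (≤-trans (m≤m+n 4 t) 4+t≤o))

  OnSquare : ℕ → Set
  OnSquare o = ∃[ i ] i < 4 × square i ≡ o

  OnPath : ℕ → ℕ → Set
  OnPath k o = ∃[ i ] i < 1 + t + k × path i ≡ o

  block-cover : ∀ k {o} → o < 5 + t + k → OnSquare o ⊎ OnPath k o
  block-cover k {o} o<ℓ with o <? 2
  ... | yes o<2 = inj₁ (o , ≤-trans o<2 (m≤m+n 2 2) , square-low o<2)
  ... | no o≮2 with o <? 2 + t | path-descending {o} (≮⇒≥ o≮2)
  ...   | yes o<2+t | descending =
    let (below , on-path) = descending o<2+t in inj₂ (_ , <-trans below (t<1+t+k k) , on-path)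
  ...   | no o≮2+t | _ with o <? 4 + t
  ...     | yes o<4+t = inj₁ (square-middle (≮⇒≥ o≮2+t) o<4+t)
  ...     | no o≮4+t =
    inj₂ (o ∸ 4 , ∸-monoˡ-< o<ℓ (≤-trans (m≤m+n 4 t) (≮⇒≥ o≮4+t)) , path-ascending (≮⇒≥ o≮4+t))

Corner : ℕ → ℕ → ℕ → Set
Corner s b o = o ≡ b ⊎ o ≡ b + 1 ⊎ o ≡ b + s ⊎ o ≡ b + s + 1

corner-≤ : ∀ {s b o} → Corner s b o → o ≤ b + s + 1
corner-≤ {s} {b} (inj₁ refl)               = ≤-trans (m≤m+n b s) (m≤m+n (b + s) 1)
corner-≤ {s} {b} (inj₂ (inj₁ refl))        = +-monoˡ-≤ 1 (m≤m+n b s)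
corner-≤ {s} {b} (inj₂ (inj₂ (inj₁ refl))) = m≤m+n (b + s) 1
corner-≤         (inj₂ (inj₂ (inj₂ refl))) = ≤-refl

Strip : ℕ → ℕ → ℕ → Set
Strip s d o = (2 ≤ o × o < s) ⊎ (s + 2 ≤ o × o < d) ⊎ (d + 2 ≤ o × o < d + s)

<⊎≡+ : ∀ h i → i < h ⊎ ∃[ j ] i ≡ h + j
<⊎≡+ h i with i <? h
... | yes i<h = inj₁ i<h
... | no i≮h  = inj₂ (_ , sym (m+[n∸m]≡n (≮⇒≥ i≮h)))

-- s = 2 + t, d = 5 + t + k, n = d + (5 + t + m): a block at 0 and a block at d, whose paths
-- are joined into the long cycle by the jumps d-1 → d+s-1 and n-1 → s-1 (mod n). The cycles
-- fz, fs fz and fs (fs fz) are the square at 0, the square at d and the long cycle.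
module TwoSquares (t k m : ℕ) (0<t : 0 < t) where
  open Block t

  longCycle : ℕ → ℕ
  longCycle i with i <? 1 + t + k
  ... | yes _ = path i
  ... | no _  = 5 + t + k + path (i ∸ (1 + t + k))

  longCycle-< : ∀ {i} → i < 1 + t + k → longCycle i ≡ path i
  longCycle-< {i} i<h with i <? 1 + t + k
  ... | yes _ = refl
  ... | no i≮h = contradiction i<h i≮h

  longCycle-+ : ∀ j → longCycle (1 + t + k + j) ≡ 5 + t + k + path j
  longCycle-+ j with 1 + t + k + j <? 1 + t + k
  ... | yes h+j<h = contradiction h+j<h (m+n≮m (1 + t + k) j)
  ... | no _ = cong (λ r → 5 + t + k + path r) (m+n∸m≡n (1 + t + k) j)

  longCycle-boundary : longCycle (1 + t + k) ≡ 5 + t + k + (1 + t)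
  longCycle-boundary = begin
    longCycle (1 + t + k)     ≡⟨ cong longCycle (+-identityʳ (1 + t + k)) ⟨
    longCycle (1 + t + k + 0) ≡⟨ longCycle-+ 0 ⟩
    5 + t + k + path 0        ≡⟨ cong (5 + t + k +_) (path-< 0<t) ⟩
    5 + t + k + (1 + t)       ∎
    where open ≡-Reasoning

  longCycle-adjacent : ∀ {n} i → Adjacent n (2 + t) (longCycle i) (longCycle (suc i))
  longCycle-adjacent i with <-cmp (suc i) (1 + t + k)
  ... | tri< 1+i<h _ _ rewrite longCycle-< 1+i<h | longCycle-< (<-trans (n<1+n i) 1+i<h) = path-adjacent i
  ... | tri≈ _ refl _ rewrite longCycle-< (n<1+n (t + k)) | path-≥ (m≤m+n t k) | longCycle-boundary =
    jump (cong (4 +_) (+-suc (t + k) (1 + t)))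
  ... | tri> _ _ h<1+i with <⊎≡+ (1 + t + k) i
  ...   | inj₁ i<h = contradiction h<1+i (≤⇒≯ i<h)
  ...   | inj₂ (j , refl) = subst₂ (Adjacent _ _) (sym (longCycle-+ j)) next≡
    (Adjacent-+ (5 + t + k) (path-adjacent j))
    where
    next≡ : 5 + t + k + path (suc j) ≡ longCycle (suc (1 + t + k + j))
    next≡ = trans (sym (longCycle-+ (suc j))) (cong longCycle (+-suc (1 + t + k) j))

  n : ℕ
  n = 5 + t + k + (5 + t + m)

  longCycle-closing : Adjacent n (2 + t) (longCycle (1 + t + k + (1 + t + m) ∸ 1)) (longCycle 0)
  longCycle-closing = subst₂ (Adjacent n (2 + t)) (sym last≡) (sym first≡) (jumpAround (wrap t k m))
    where
    open ≡-Reasoning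
    last≡ : longCycle (1 + t + k + (1 + t + m) ∸ 1) ≡ 5 + t + k + (4 + (t + m))
    last≡ = begin
      longCycle (1 + t + k + suc (t + m) ∸ 1) ≡⟨ cong (λ r → longCycle (r ∸ 1)) (+-suc (1 + t + k) (t + m)) ⟩
      longCycle (1 + t + k + (t + m))         ≡⟨ longCycle-+ (t + m) ⟩
      5 + t + k + path (t + m)                ≡⟨ cong (5 + t + k +_) (path-≥ (m≤m+n t m)) ⟩
      5 + t + k + (4 + (t + m))               ∎
    first≡ : longCycle 0 ≡ 1 + t
    first≡ = trans (longCycle-< (s≤s z≤n)) (path-< 0<t)
    wrap : ∀ t k m → 5 + t + k + (4 + (t + m)) + (2 + t) ≡ 1 + t + (5 + t + k + (5 + t + m))
    wrap = solve-∀

  length : Fin 3 → ℕ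
  length fz           = 4
  length (fs fz)      = 4
  length (fs (fs fz)) = 1 + t + k + (1 + t + m)

  offset : Fin 3 → ℕ → ℕ
  offset fz           i = square i
  offset (fs fz)      i = 5 + t + k + square i
  offset (fs (fs fz)) i = longCycle i

  inFirstBlock inSecondBlock : ℕ ⊎ ℕ → Fin 3 × ℕ
  inFirstBlock  = [ (fz ,_) , (fs (fs fz) ,_) ]′
  inSecondBlock = [ (fs fz ,_) , (λ i → fs (fs fz) , 1 + t + k + i) ]′

  locate : ℕ → Fin 3 × ℕ
  locate o with o <? 5 + t + k
  ... | yes _ = inFirstBlock (position o)
  ... | no _  = inSecondBlock (position (o ∸ (5 + t + k)))

  locate-< : ∀ {o} → o < 5 + t + k → locate o ≡ inFirstBlock (position o)
  locate-< {o} o<d with o <? 5 + t + k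
  ... | yes _ = refl
  ... | no o≮d = contradiction o<d o≮d

  locate-+ : ∀ o → locate (5 + t + k + o) ≡ inSecondBlock (position o)
  locate-+ o with 5 + t + k + o <? 5 + t + k
  ... | yes d+o<d = contradiction d+o<d (m+n≮m (5 + t + k) o)
  ... | no _ = cong (inSecondBlock ∘ position) (m+n∸m≡n (5 + t + k) o)

  d≤n : 5 + t + k ≤ n
  d≤n = m≤m+n (5 + t + k) (5 + t + m)

  offset<n : ∀ j i → i < length j → offset j i < n
  offset<n fz           i i<4 = <-≤-trans (square-bound k i<4) d≤n
  offset<n (fs fz)      i i<4 = +-monoʳ-< (5 + t + k) (square-bound m i<4)
  offset<n (fs (fs fz)) i i<ℓ with <⊎≡+ (1 + t + k) i
  ... | inj₁ i<h = subst (_< n) (sym (longCycle-< i<h)) (<-≤-trans (path-bound k i<h) d≤n)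
  ... | inj₂ (j , refl) =
    subst (_< n) (sym (longCycle-+ j)) (+-monoʳ-< (5 + t + k) (path-bound m (+-cancelˡ-< (1 + t + k) _ _ i<ℓ)))

  adjacent : ∀ j i → suc i < length j → Adjacent n (2 + t) (offset j i) (offset j (suc i))
  adjacent fz           i 1+i<4 = square-adjacent (s≤s⁻¹ 1+i<4)
  adjacent (fs fz)      i 1+i<4 = Adjacent-+ (5 + t + k) (square-adjacent (s≤s⁻¹ 1+i<4))
  adjacent (fs (fs fz)) i _     = longCycle-adjacent i

  closing : ∀ j → Adjacent n (2 + t) (offset j (length j ∸ 1)) (offset j 0)
  closing fz           = square-closing
  closing (fs fz)      = Adjacent-+ (5 + t + k) square-closing
  closing (fs (fs fz)) = longCycle-closing

  locate-offset : ∀ j i → i < length j → locate (offset j i) ≡ (j , i)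
  locate-offset fz           i i<4 rewrite locate-< (square-bound k i<4) | position-square i<4 = refl
  locate-offset (fs fz)      i i<4 rewrite locate-+ (square i) | position-square i<4 = refl
  locate-offset (fs (fs fz)) i _ with <⊎≡+ (1 + t + k) i
  ... | inj₁ i<h rewrite longCycle-< i<h | locate-< (path-bound k i<h) | position-path i = refl
  ... | inj₂ (j , refl) rewrite longCycle-+ j | locate-+ (path j) | position-path j = refl

  offset-surjective : ∀ o → o < n → ∃[ j ] ∃[ i ] i < length j × offset j i ≡ o
  offset-surjective o o<n with o <? 5 + t + k
  ... | yes o<d with block-cover k o<d
  ...   | inj₁ (i , i<4 , eq)   = fz , i , i<4 , eq
  ...   | inj₂ (i , i<h , eq)   = fs (fs fz) , i , <-≤-trans i<h (m≤m+n _ _) , trans (longCycle-< i<h) eq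
  offset-surjective o o<n | no o≮d with m≤n⇒∃[o]m+o≡n (≮⇒≥ o≮d)
  ... | o′ , refl with block-cover m (+-cancelˡ-< (5 + t + k) _ _ o<n)
  ...   | inj₁ (i , i<4 , eq)   = fs fz , i , i<4 , cong (5 + t + k +_) eq
  ...   | inj₂ (i , i<h , eq)   = fs (fs fz) , 1 + t + k + i , +-monoʳ-< (1 + t + k) i<h ,
                                  trans (longCycle-+ i) (cong (5 + t + k +_) eq)

  layout : OffsetLayout n (2 + t) 3
  layout = record
    { length = length ; 3≤length = 3≤length ; offset = offset ; offset<n = offset<n
    ; adjacent = adjacent ; closing = closing ; locate = locate ; locate-offset = locate-offset
    ; offset-surjective = offset-surjective }
    where
    3≤length : ∀ j → 3 ≤ length j
    3≤length fz           = n≤1+n 3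
    3≤length (fs fz)      = n≤1+n 3
    3≤length (fs (fs fz)) = +-mono-≤ (≤-trans (s≤s 0<t) (m≤m+n (1 + t) k)) (s≤s z≤n)

  open OffsetLayout layout using (OnCycle)

  corner-square : ∀ {b o} → Corner (2 + t) b o → ∃[ i ] i < 4 × b + square i ≡ o
  corner-square {b} (inj₁ refl)                = 0 , s≤s z≤n , +-identityʳ b
  corner-square (inj₂ (inj₁ refl))             = 1 , s≤s (s≤s z≤n) , refl
  corner-square (inj₂ (inj₂ (inj₁ refl)))      = 3 , ≤-refl , refl
  corner-square {b} (inj₂ (inj₂ (inj₂ refl)))  =
    2 , n≤1+n _ , trans (cong (b +_) (+-comm 1 (2 + t))) (sym (+-assoc b (2 + t) 1))

  strip-longCycle : ∀ {o} → Strip (2 + t) (5 + t + k) o → OnCycle (fs (fs fz)) o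
  strip-longCycle (inj₁ (2≤o , o<s)) =
    let (below , on-path) = path-descending 2≤o o<s
        i<h = <-trans below (t<1+t+k k)
    in _ , <-≤-trans i<h (m≤m+n _ _) , trans (longCycle-< i<h) on-path
  strip-longCycle {o} (inj₂ (inj₁ (s+2≤o , o<d))) =
    let 4+t≤o = subst (_≤ o) (+-comm (2 + t) 2) s+2≤o
        i<h = ∸-monoˡ-< o<d (≤-trans (m≤m+n 4 t) 4+t≤o)
    in o ∸ 4 , <-≤-trans i<h (m≤m+n _ _) , trans (longCycle-< i<h) (path-ascending 4+t≤o)
  strip-longCycle {o} (inj₂ (inj₂ (d+2≤o , o<d+s)))
    with m≤n⇒∃[o]m+o≡n (≤-trans (m≤m+n (5 + t + k) 2) d+2≤o)
  ... | o′ , refl =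
    let (below , on-path) = path-descending (+-cancelˡ-≤ (5 + t + k) 2 o′ d+2≤o)
                                            (+-cancelˡ-< (5 + t + k) o′ (2 + t) o<d+s)
    in 1 + t + k + _ , +-monoʳ-< (1 + t + k) (<-trans below (t<1+t+k m)) ,
       trans (longCycle-+ _) (cong (5 + t + k +_) on-path)

  separable : (A : Subset n) (x : ℕ) (o : Fin 3 → ℕ) →
              Corner (2 + t) 0 (o fz) → Corner (2 + t) (5 + t + k) (o (fs fz)) →
              Strip (2 + t) (5 + t + k) (o (fs (fs fz))) → Translation.ExactlyAt n A x o →
              Separable (circ n (2 + t)) 3 A
  separable A x o on-square₀ on-square₁ on-strip at = twoFactor layout x , twoFactor-separates layout x A o on-cycle at
    where
    on-cycle : ∀ j → OnCycle j (o j)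
    on-cycle fz           = corner-square on-square₀
    on-cycle (fs fz)      = corner-square on-square₁
    on-cycle (fs (fs fz)) = strip-longCycle on-strip

decompose : ∀ {s d n} → 3 ≤ s → s + 3 ≤ d → d + s + 3 ≤ n →
            ∃[ t ] ∃[ k ] ∃[ m ] 0 < t × s ≡ 2 + t × d ≡ 5 + t + k × n ≡ 5 + t + k + (5 + t + m)
decompose 3≤s s+3≤d d+s+3≤n
  with m≤n⇒∃[o]m+o≡n 3≤s | m≤n⇒∃[o]m+o≡n s+3≤d | m≤n⇒∃[o]m+o≡n d+s+3≤n
... | r , refl | k , refl | m , refl = suc r , k , m , s≤s z≤n , refl , shape₁ r k , shape₂ r k m
  where
  shape₁ : ∀ r k → 3 + r + 3 + k ≡ 5 + suc r + k
  shape₁ = solve-∀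
  shape₂ : ∀ r k m → 3 + r + 3 + k + (3 + r) + 3 + m ≡ 5 + suc r + k + (5 + suc r + m)
  shape₂ = solve-∀

separable-by-squares : ∀ {n s d} .{{_ : NonZero n}} → 3 ≤ s → s + 3 ≤ d → d + s + 3 ≤ n →
  (A : Subset n) (x : ℕ) (o : Fin 3 → ℕ) →
  Corner s 0 (o fz) → Corner s d (o (fs fz)) → Strip s d (o (fs (fs fz))) → Translation.ExactlyAt n A x o →
  Separable (circ n s) 3 A
separable-by-squares 3≤s s+3≤d d+s+3≤n with decompose 3≤s s+3≤d d+s+3≤n
... | t , k , m , 0<t , refl , refl , refl = TwoSquares.separable t k m 0<t

-- Translating by α - p sends the vertices p, p + u, p + e of A to α on the square at 0,
-- α + e on the square at d and α + u on the long cycle.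
record Placement (s n u e : ℕ) : Set where
  field
    d α      : ℕ
    s+3≤d    : s + 3 ≤ d
    d+s+3≤n  : d + s + 3 ≤ n
    corner₀  : Corner s 0 α
    corner-d : Corner s d (α + e)
    strip    : Strip s d (α + u)

s+2≤s+1+u : ∀ s {u} → 1 ≤ u → s + 2 ≤ s + 1 + u
s+2≤s+1+u s {u} 1≤u = subst (_≤ s + 1 + u) (+-assoc s 1 1) (+-monoʳ-≤ (s + 1) 1≤u)

gap-fits : ∀ {s g} a → s + 3 ≤ g → a + s + 3 ≤ a + g
gap-fits {s} {g} a s+3≤g = subst (_≤ a + g) (sym (+-assoc a s 3)) (+-monoʳ-≤ a s+3≤g)

placement-short : ∀ {s u v g} → 3 ≤ s → 4 * s + 3 ≤ u + v + g → 1 ≤ u → 1 ≤ v → u + v ≤ s + 2 →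
                  Placement s (u + v + g) u (u + v)
placement-short {s} {u} {v} {g} 3≤s 4s+3≤n 1≤u 1≤v short = record
  { d = s + 1 + (u + v) ; α = s + 1
  ; s+3≤d    = subst (_≤ s + 1 + (u + v)) (+-assoc s 1 2) (+-monoʳ-≤ (s + 1) (+-mono-≤ 1≤u 1≤v))
  ; d+s+3≤n  = subst (_≤ u + v + g) (rearrange s u v) (+-monoʳ-≤ (u + v) 2s+4≤g)
  ; corner₀  = inj₂ (inj₂ (inj₂ refl))
  ; corner-d = inj₁ refl
  ; strip    = inj₂ (inj₁ (s+2≤s+1+u s 1≤u , +-monoʳ-< (s + 1) (m<m+n u 1≤v)))
  }
  where
  open ≤-Reasoning
  rearrange : ∀ s u v → u + v + (s + s + 4) ≡ s + 1 + (u + v) + s + 3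
  rearrange = solve-∀
  3s+1≤g : 3 * s + 1 ≤ g
  3s+1≤g = +-cancelˡ-≤ (s + 2) _ _ (begin
    s + 2 + (3 * s + 1) ≡⟨ e₁ s ⟩
    4 * s + 3           ≤⟨ 4s+3≤n ⟩
    u + v + g           ≤⟨ +-monoˡ-≤ g short ⟩
    s + 2 + g           ∎)
    where
    e₁ : ∀ s → s + 2 + (3 * s + 1) ≡ 4 * s + 3
    e₁ = solve-∀
  2s+4≤g : s + s + 4 ≤ g
  2s+4≤g = begin
    s + s + 4     ≡⟨ e₂ s ⟩
    s + s + 1 + 3 ≤⟨ +-monoʳ-≤ (s + s + 1) 3≤s ⟩
    s + s + 1 + s ≡⟨ e₃ s ⟩
    3 * s + 1     ≤⟨ 3s+1≤g ⟩
    g             ∎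
    where
    e₂ : ∀ s → s + s + 4 ≡ s + s + 1 + 3
    e₂ = solve-∀
    e₃ : ∀ s → s + s + 1 + s ≡ 3 * s + 1
    e₃ = solve-∀

placement-far-second : ∀ {s u v g} → s + 3 ≤ g → s + 3 ≤ u + v → 1 ≤ u → s + 1 < v →
                       Placement s (u + v + g) u (u + v)
placement-far-second {s} {u} {v} s+3≤g long 1≤u far = record
  { d = u + v ; α = s + 1
  ; s+3≤d    = long
  ; d+s+3≤n  = gap-fits (u + v) s+3≤g
  ; corner₀  = inj₂ (inj₂ (inj₂ refl))
  ; corner-d = inj₂ (inj₂ (inj₂ (swap s u v)))
  ; strip    = inj₂ (inj₁ (s+2≤s+1+u s 1≤u , subst (_< u + v) (+-comm u (s + 1)) (+-monoʳ-< u far)))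
  }
  where
  swap : ∀ s u v → s + 1 + (u + v) ≡ u + v + s + 1
  swap = solve-∀

placement-u≡s+1 : ∀ {s v g} → s + 3 ≤ g → s + 3 ≤ s + 1 + v → Placement s (s + 1 + v + g) (s + 1) (s + 1 + v)
placement-u≡s+1 {s} {v} s+3≤g long = record
  { d = s + 1 + v ; α = 1
  ; s+3≤d    = long
  ; d+s+3≤n  = gap-fits (s + 1 + v) s+3≤g
  ; corner₀  = inj₂ (inj₁ refl)
  ; corner-d = inj₂ (inj₁ (+-comm 1 (s + 1 + v)))
  ; strip    = inj₂ (inj₁ ( ≤-reflexive (+-suc s 1)
                          , subst (_≤ s + 1 + v) (+-comm (s + 1) 2) (+-monoʳ-≤ (s + 1) 2≤v)))
  }
  where
  2≤v : 2 ≤ v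
  2≤v = +-cancelˡ-≤ (s + 1) 2 v (subst (_≤ s + 1 + v) (sym (+-assoc s 1 2)) long)

placement-u≡s : ∀ {s v g} → 3 ≤ s → 4 * s + 3 ≤ s + v + g → s + 3 ≤ s + v → v ≤ s + 1 →
                Placement s (s + v + g) s (s + v)
placement-u≡s {s} {zero} _ _ long _ = contradiction (+-cancelˡ-≤ s 3 0 long) λ ()
placement-u≡s {s} {suc v′} {g} 3≤s 4s+3≤n long near = record
  { d = s + v′ + s ; α = s
  ; s+3≤d    = ≤-trans (+-monoʳ-≤ s 3≤s) (+-monoˡ-≤ s (m≤m+n s v′))
  ; d+s+3≤n  = ≤-trans (+-monoˡ-≤ 3 (+-monoˡ-≤ s (+-monoˡ-≤ s (+-monoʳ-≤ s v′≤s))))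
                       (subst (_≤ s + suc v′ + g) (four s) 4s+3≤n)
  ; corner₀  = inj₂ (inj₂ (inj₁ refl))
  ; corner-d = inj₂ (inj₁ (corner s v′))
  ; strip    = inj₂ (inj₁ (+-monoʳ-≤ s (≤-trans (n≤1+n 2) 3≤s) ,
                           subst (_< s + v′ + s) (cong (_+ s) (+-identityʳ s)) (+-monoˡ-< s (+-monoʳ-< s 0<v′))))
  }
  where
  v′≤s : v′ ≤ s
  v′≤s = s≤s⁻¹ (subst (suc v′ ≤_) (+-comm s 1) near)
  0<v′ : 0 < v′
  0<v′ = ≤-trans (n≤1+n 1) (s≤s⁻¹ (+-cancelˡ-≤ s 3 (suc v′) long))
  four : ∀ s → 4 * s + 3 ≡ s + s + s + s + 3
  four = solve-∀
  corner : ∀ s v′ → s + (s + suc v′) ≡ s + v′ + s + 1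
  corner = solve-∀

placement-generic : ∀ {s u v g} → s + 3 ≤ g → s + 3 ≤ u + v → 1 ≤ v → 2 ≤ u → u ≢ s → u ≢ s + 1 →
                    Placement s (u + v + g) u (u + v)
placement-generic {s} {u} {v} s+3≤g long 1≤v 2≤u u≢s u≢s+1 = record
  { d = u + v ; α = 0
  ; s+3≤d    = long
  ; d+s+3≤n  = gap-fits (u + v) s+3≤g
  ; corner₀  = inj₁ refl
  ; corner-d = inj₁ refl
  ; strip    = on-strip
  }
  where
  on-strip : Strip s (u + v) u
  on-strip with u <? s
  ... | yes u<s = inj₁ (2≤u , u<s)
  ... | no u≮s  = inj₂ (inj₁ (s+2≤u , m<m+n u 1≤v))
    where
    s+2≤u : s + 2 ≤ u
    s+2≤u = subst (_≤ u) (+-comm 2 s)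
      (≤∧≢⇒< (≤∧≢⇒< (≮⇒≥ u≮s) (u≢s ∘ sym)) (λ 1+s≡u → u≢s+1 (trans (sym 1+s≡u) (+-comm 1 s))))

-- The one configuration in which no gap is at least s + 3.
placement-15 : ∀ {s n u e} → s ≡ 3 → n ≡ 15 → u ≡ 5 → e ≡ 10 → Placement s n u e
placement-15 refl refl refl refl = record
  { d = 8 ; α = 1
  ; s+3≤d    = m≤m+n 6 2
  ; d+s+3≤n  = n≤1+n 14
  ; corner₀  = inj₂ (inj₁ refl)
  ; corner-d = inj₂ (inj₂ (inj₁ refl))
  ; strip    = inj₂ (inj₁ (n≤1+n 5 , n≤1+n 7))
  }

placement-long : ∀ {s u v g} → 3 ≤ s → 4 * s + 3 ≤ u + v + g → 1 ≤ u → 1 ≤ v → s + 3 ≤ g → s + 3 ≤ u + v →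
                 Placement s (u + v + g) u (u + v)
placement-long {s} {u} {v} 3≤s 4s+3≤n 1≤u 1≤v s+3≤g long with v ≤? s + 1
... | no ¬near = placement-far-second s+3≤g long 1≤u (≰⇒> ¬near)
... | yes near with u ≟ s | u ≟ s + 1
...   | yes refl | _        = placement-u≡s 3≤s 4s+3≤n long near
...   | no _     | yes refl = placement-u≡s+1 s+3≤g long
...   | no u≢s   | no u≢s+1 = placement-generic s+3≤g long 1≤v 2≤u u≢s u≢s+1
  where
  2≤u : 2 ≤ u
  2≤u = +-cancelˡ-≤ (s + 1) 2 u (begin
    s + 1 + 2 ≡⟨ +-assoc s 1 2 ⟩
    s + 3     ≤⟨ long ⟩
    u + v     ≤⟨ +-monoʳ-≤ u near ⟩
    u + (s + 1) ≡⟨ +-comm u (s + 1) ⟩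
    s + 1 + u ∎)
    where open ≤-Reasoning

placement : ∀ {s n u v g} → 3 ≤ s → 4 * s + 3 ≤ n → 1 ≤ u → 1 ≤ v → s + 3 ≤ g → u + v + g ≡ n →
            Placement s n u (u + v)
placement {s} {u = u} {v} 3≤s 4s+3≤n 1≤u 1≤v s+3≤g refl with u + v ≤? s + 2
... | yes short = placement-short 3≤s 4s+3≤n 1≤u 1≤v short
... | no ¬short = placement-long 3≤s 4s+3≤n 1≤u 1≤v s+3≤g (subst (_≤ u + v) (sym (+-suc s 2)) (≰⇒> ¬short))

record Enumeration {n : ℕ} (A : Subset n) (k : ℕ) : Set where
  field
    element    : Fin k → Fin n
    increasing : ∀ {i j} → toℕ i < toℕ j → toℕ (element i) < toℕ (element j)
    element∈A  : ∀ i → element i ∈ A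
    ∈A⇒element : ∀ v → v ∈ A → ∃[ i ] v ≡ element i

enumerate : ∀ {n} (A : Subset n) → Enumeration A ∣ A ∣
enumerate [] = record { element = λ () ; increasing = λ { {()} } ; element∈A = λ () ; ∈A⇒element = λ () }
enumerate (outside ∷ A) = record
  { element    = fs ∘ element
  ; increasing = s≤s ∘ increasing
  ; element∈A  = there ∘ element∈A
  ; ∈A⇒element = λ { (fs v) (there v∈A) → let (i , v≡) = ∈A⇒element v v∈A in i , cong fs v≡ }
  }
  where open Enumeration (enumerate A)
enumerate {suc n} (inside ∷ A) = record
  { element = element′ ; increasing = increasing′ ; element∈A = element∈A′ ; ∈A⇒element = ∈A⇒element′ }
  where
  open Enumeration (enumerate A)
  element′ : Fin (suc ∣ A ∣) → Fin (suc n)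
  element′ fz     = fz
  element′ (fs i) = fs (element i)
  increasing′ : ∀ {i j} → toℕ i < toℕ j → toℕ (element′ i) < toℕ (element′ j)
  increasing′ {fz}   {fs _} _         = s≤s z≤n
  increasing′ {fs _} {fs _} (s≤s i<j) = s≤s (increasing i<j)
  element∈A′ : ∀ i → element′ i ∈ inside ∷ A
  element∈A′ fz     = here
  element∈A′ (fs i) = there (element∈A i)
  ∈A⇒element′ : ∀ v → v ∈ inside ∷ A → ∃[ i ] v ≡ element′ i
  ∈A⇒element′ fz     _           = fz , refl
  ∈A⇒element′ (fs v) (there v∈A) = let (i , v≡) = ∈A⇒element v v∈A in fs i , cong fs v≡

small-gaps-force-s≡3 : ∀ {s a b c} → 3 ≤ s → 4 * s + 3 ≤ a + b + c →
                       a ≤ s + 2 → b ≤ s + 2 → c ≤ s + 2 → s ≡ 3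
small-gaps-force-s≡3 {s} {a} {b} {c} 3≤s big a≤ b≤ c≤ = ≤-antisym s≤3 3≤s
  where
  open ≤-Reasoning
  s≤3 : s ≤ 3
  s≤3 = +-cancelʳ-≤ (3 * s + 3) s 3 (begin
    s + (3 * s + 3)             ≡⟨ e₁ s ⟩
    4 * s + 3                   ≤⟨ big ⟩
    a + b + c                   ≤⟨ +-mono-≤ (+-mono-≤ a≤ b≤) c≤ ⟩
    s + 2 + (s + 2) + (s + 2)   ≡⟨ e₂ s ⟩
    3 + (3 * s + 3)             ∎)
    where
    e₁ : ∀ s → s + (3 * s + 3) ≡ 4 * s + 3
    e₁ = solve-∀
    e₂ : ∀ s → s + 2 + (s + 2) + (s + 2) ≡ 3 + (3 * s + 3)
    e₂ = solve-∀

gaps≤5⇒gaps≡5 : ∀ {a b c} → 15 ≤ a + b + c → a ≤ 5 → b ≤ 5 → c ≤ 5 → a ≡ 5 × b ≡ 5 × c ≡ 5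
gaps≤5⇒gaps≡5 {a} {b} {c} big a≤ b≤ c≤ = ≤-antisym a≤ 5≤a , ≤-antisym b≤ 5≤b , ≤-antisym c≤ 5≤c
  where
  open ≤-Reasoning
  5≤a : 5 ≤ a
  5≤a = +-cancelʳ-≤ 10 5 a (begin
    15         ≤⟨ big ⟩
    a + b + c  ≤⟨ +-mono-≤ (+-monoʳ-≤ a b≤) c≤ ⟩
    a + 5 + 5  ≡⟨ +-assoc a 5 5 ⟩
    a + 10     ∎)
  5≤b : 5 ≤ b
  5≤b = +-cancelʳ-≤ 10 5 b (begin
    15         ≤⟨ big ⟩
    a + b + c  ≤⟨ +-mono-≤ (+-monoˡ-≤ b a≤) c≤ ⟩
    5 + b + 5  ≡⟨ trans (+-comm (5 + b) 5) (+-comm 10 b) ⟩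
    b + 10     ∎)
  5≤c : 5 ≤ c
  5≤c = +-cancelʳ-≤ 10 5 c (begin
    15         ≤⟨ big ⟩
    a + b + c  ≤⟨ +-monoˡ-≤ c (+-mono-≤ a≤ b≤) ⟩
    5 + 5 + c  ≡⟨ +-comm 10 c ⟩
    c + 10     ∎)

≰+3⇒≤+2 : ∀ {s g} → ¬ (s + 3 ≤ g) → g ≤ s + 2
≰+3⇒≤+2 {s} {g} s+3≰g = s≤s⁻¹ (subst (g <_) (+-suc s 2) (≰⇒> s+3≰g))

gap-sum : ∀ {a b c n r₀ r₁ r₂} → suc a + r₀ ≡ b → suc b + r₁ ≡ c → suc c + r₂ ≡ n →
          suc r₀ + suc r₁ + suc (r₂ + a) ≡ n
gap-sum {a} {r₀ = r₀} {r₁} {r₂} refl refl refl = e a r₀ r₁ r₂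
  where
  e : ∀ a r₀ r₁ r₂ → suc r₀ + suc r₁ + suc (r₂ + a) ≡ suc (suc (suc a + r₀) + r₁) + r₂
  e = solve-∀

module _ {n : ℕ} .{{_ : NonZero n}} where
  open Translation n

  record CyclicOrder (A : Subset n) : Set where
    field
      p₀ p₁ p₂ : Fin n
      g₀ g₁ g₂ : ℕ
      0<g₀ : 0 < g₀
      0<g₁ : 0 < g₁
      0<g₂ : 0 < g₂
      p₀+g₀ : vertexAt (toℕ p₀) g₀ ≡ p₁
      p₁+g₁ : vertexAt (toℕ p₁) g₁ ≡ p₂
      p₂+g₂ : vertexAt (toℕ p₂) g₂ ≡ p₀
      total : g₀ + g₁ + g₂ ≡ n
      p₀∈A : p₀ ∈ A
      p₁∈A : p₁ ∈ A
      p₂∈A : p₂ ∈ A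
      ∈A   : ∀ v → v ∈ A → v ≡ p₀ ⊎ v ≡ p₁ ⊎ v ≡ p₂

  rotate : ∀ {A} → CyclicOrder A → CyclicOrder A
  rotate T = record
    { p₀ = p₁ ; p₁ = p₂ ; p₂ = p₀ ; g₀ = g₁ ; g₁ = g₂ ; g₂ = g₀
    ; 0<g₀ = 0<g₁ ; 0<g₁ = 0<g₂ ; 0<g₂ = 0<g₀
    ; p₀+g₀ = p₁+g₁ ; p₁+g₁ = p₂+g₂ ; p₂+g₂ = p₀+g₀
    ; total = trans (trans (+-comm (g₁ + g₂) g₀) (sym (+-assoc g₀ g₁ g₂))) total
    ; p₀∈A = p₁∈A ; p₁∈A = p₂∈A ; p₂∈A = p₀∈A
    ; ∈A = λ v v∈A → case-rotate (∈A v v∈A)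
    }
    where
    open CyclicOrder T
    case-rotate : ∀ {v} → v ≡ p₀ ⊎ v ≡ p₁ ⊎ v ≡ p₂ → v ≡ p₁ ⊎ v ≡ p₂ ⊎ v ≡ p₀
    case-rotate (inj₁ v≡p₀)        = inj₂ (inj₂ v≡p₀)
    case-rotate (inj₂ (inj₁ v≡p₁)) = inj₁ v≡p₁
    case-rotate (inj₂ (inj₂ v≡p₂)) = inj₂ (inj₁ v≡p₂)

  cyclicOrder : (A : Subset n) → ∣ A ∣ ≡ 3 → CyclicOrder A
  cyclicOrder A ∣A∣≡3 = fromEnumeration (subst (Enumeration A) ∣A∣≡3 (enumerate A))
    where
    fromEnumeration : Enumeration A 3 → CyclicOrder A
    fromEnumeration E = record
      { p₀ = a ; p₁ = b ; p₂ = c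
      ; g₀ = suc r₀ ; g₁ = suc r₁ ; g₂ = suc (r₂ + toℕ a)
      ; 0<g₀ = s≤s z≤n ; 0<g₁ = s≤s z≤n ; 0<g₂ = s≤s z≤n
      ; p₀+g₀ = vertexAt-≡ (toℕ a) (suc r₀) b (trans (+-suc (toℕ a) r₀) a+r₀)
      ; p₁+g₁ = vertexAt-≡ (toℕ b) (suc r₁) c (trans (+-suc (toℕ b) r₁) b+r₁)
      ; p₂+g₂ = vertexAt-≡+n (toℕ c) (suc (r₂ + toℕ a)) a (wrap (toℕ c) r₂ (toℕ a) c+r₂)
      ; total = gap-sum a+r₀ b+r₁ c+r₂
      ; p₀∈A = element∈A fz ; p₁∈A = element∈A (fs fz) ; p₂∈A = element∈A (fs (fs fz))
      ; ∈A = λ v v∈A → which (∈A⇒element v v∈A)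
      }
      where
      open Enumeration E
      a b c : Fin n
      a = element fz
      b = element (fs fz)
      c = element (fs (fs fz))
      r₀ r₁ r₂ : ℕ
      r₀ = proj₁ (m≤n⇒∃[o]m+o≡n (increasing {fz} {fs fz} (s≤s z≤n)))
      r₁ = proj₁ (m≤n⇒∃[o]m+o≡n (increasing {fs fz} {fs (fs fz)} (s≤s (s≤s z≤n))))
      r₂ = proj₁ (m≤n⇒∃[o]m+o≡n (toℕ<n c))
      a+r₀ : suc (toℕ a) + r₀ ≡ toℕ b
      a+r₀ = proj₂ (m≤n⇒∃[o]m+o≡n (increasing {fz} {fs fz} (s≤s z≤n)))
      b+r₁ : suc (toℕ b) + r₁ ≡ toℕ c
      b+r₁ = proj₂ (m≤n⇒∃[o]m+o≡n (increasing {fs fz} {fs (fs fz)} (s≤s (s≤s z≤n))))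
      c+r₂ : suc (toℕ c) + r₂ ≡ n
      c+r₂ = proj₂ (m≤n⇒∃[o]m+o≡n (toℕ<n c))
      wrap : ∀ c r a → suc c + r ≡ n → c + suc (r + a) ≡ a + n
      wrap c r a refl = e c r a
        where
        e : ∀ c r a → c + suc (r + a) ≡ a + (suc c + r)
        e = solve-∀
      which : ∀ {v} → ∃[ i ] v ≡ element i → v ≡ a ⊎ v ≡ b ⊎ v ≡ c
      which (fz , v≡)         = inj₁ v≡
      which (fs fz , v≡)      = inj₂ (inj₁ v≡)
      which (fs (fs fz) , v≡) = inj₂ (inj₂ v≡)

  module _ {A : Subset n} (T : CyclicOrder A) where
    open CyclicOrder T

    placedOffsets : ℕ → Fin 3 → ℕ
    placedOffsets α fz           = α
    placedOffsets α (fs fz)      = α + (g₀ + g₁)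
    placedOffsets α (fs (fs fz)) = α + g₀

    exactlyAt-placedOffsets : ∀ {α} → α ≤ n → ExactlyAt A (toℕ p₀ + (n ∸ α)) (placedOffsets α)
    exactlyAt-placedOffsets {α} α≤n = record { at∈A = at∈A ; ∈A⇒at = ∈A⇒at }
      where
      open ≡-Reasoning
      x : ℕ
      x = toℕ p₀ + (n ∸ α)
      at-p₀ : vertexAt x α ≡ p₀
      at-p₀ = begin
        vertexAt x α              ≡⟨ cong (vertexAt x) (+-identityʳ α) ⟨
        vertexAt x (α + 0)        ≡⟨ vertexAt-shift (toℕ p₀) 0 α≤n ⟩
        vertexAt (toℕ p₀) 0       ≡⟨ vertexAt-≡ (toℕ p₀) 0 p₀ (+-identityʳ (toℕ p₀)) ⟩
        p₀                        ∎
      at-p₁ : vertexAt x (α + g₀) ≡ p₁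
      at-p₁ = trans (vertexAt-shift (toℕ p₀) g₀ α≤n) p₀+g₀
      at-p₂ : vertexAt x (α + (g₀ + g₁)) ≡ p₂
      at-p₂ = begin
        vertexAt x (α + (g₀ + g₁))               ≡⟨ vertexAt-shift (toℕ p₀) (g₀ + g₁) α≤n ⟩
        vertexAt (toℕ p₀) (g₀ + g₁)              ≡⟨ vertexAt-vertexAt (toℕ p₀) g₀ g₁ ⟨
        vertexAt (toℕ (vertexAt (toℕ p₀) g₀)) g₁ ≡⟨ cong (λ v → vertexAt (toℕ v) g₁) p₀+g₀ ⟩
        vertexAt (toℕ p₁) g₁                     ≡⟨ p₁+g₁ ⟩
        p₂                                       ∎
      at∈A : ∀ j → vertexAt x (placedOffsets α j) ∈ A
      at∈A fz           = subst (_∈ A) (sym at-p₀) p₀∈A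
      at∈A (fs fz)      = subst (_∈ A) (sym at-p₂) p₂∈A
      at∈A (fs (fs fz)) = subst (_∈ A) (sym at-p₁) p₁∈A
      ∈A⇒at : ∀ v → v ∈ A → ∃[ j ] v ≡ vertexAt x (placedOffsets α j)
      ∈A⇒at v v∈A with ∈A v v∈A
      ... | inj₁ v≡p₀        = fz , trans v≡p₀ (sym at-p₀)
      ... | inj₂ (inj₁ v≡p₁) = fs (fs fz) , trans v≡p₁ (sym at-p₁)
      ... | inj₂ (inj₂ v≡p₂) = fs fz , trans v≡p₂ (sym at-p₂)

    separable-by-placement : ∀ {s} → 3 ≤ s → Placement s n g₀ (g₀ + g₁) → Separable (circ n s) 3 A
    separable-by-placement {s} 3≤s P =
      separable-by-squares 3≤s s+3≤d d+s+3≤n A _ _ corner₀ corner-d strip (exactlyAt-placedOffsets α≤n)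
      where
      open Placement P
      α≤n : α ≤ n
      α≤n = ≤-trans (corner-≤ corner₀) (≤-trans (+-monoʳ-≤ s (s≤s z≤n)) (≤-trans s+3≤d d≤n))
        where
        d≤n : d ≤ n
        d≤n = m+n≤o⇒m≤o d (m+n≤o⇒m≤o (d + s) d+s+3≤n)

    placement-wide : ∀ {s} → 3 ≤ s → 4 * s + 3 ≤ n → s + 3 ≤ g₂ → Placement s n g₀ (g₀ + g₁)
    placement-wide 3≤s 4s+3≤n wide = placement 3≤s 4s+3≤n 0<g₀ 0<g₁ wide total

    placement-narrow : ∀ {s} → 3 ≤ s → 4 * s + 3 ≤ n → g₀ ≤ s + 2 → g₁ ≤ s + 2 → g₂ ≤ s + 2 →
                       Placement s n g₀ (g₀ + g₁)
    placement-narrow {s} 3≤s 4s+3≤n narrow₀ narrow₁ narrow₂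
      with small-gaps-force-s≡3 3≤s (subst (4 * s + 3 ≤_) (sym total) 4s+3≤n) narrow₀ narrow₁ narrow₂
    ... | refl with gaps≤5⇒gaps≡5 (subst (15 ≤_) (sym total) 4s+3≤n) narrow₀ narrow₁ narrow₂
    ...   | g₀≡5 , g₁≡5 , g₂≡5 =
      placement-15 refl (trans (sym total) (cong₂ _+_ (cong₂ _+_ g₀≡5 g₁≡5) g₂≡5)) g₀≡5 (cong₂ _+_ g₀≡5 g₁≡5)

  placeable : ∀ {s A} → 3 ≤ s → 4 * s + 3 ≤ n → CyclicOrder A →
              Σ (CyclicOrder A) (λ T → Placement s n (CyclicOrder.g₀ T) (CyclicOrder.g₀ T + CyclicOrder.g₁ T))
  placeable {s} 3≤s 4s+3≤n T
    with s + 3 ≤? CyclicOrder.g₂ T | s + 3 ≤? CyclicOrder.g₀ T | s + 3 ≤? CyclicOrder.g₁ T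
  ... | yes wide | _        | _        = T , placement-wide T 3≤s 4s+3≤n wide
  ... | no _     | yes wide | _        = rotate T , placement-wide (rotate T) 3≤s 4s+3≤n wide
  ... | no _     | no _     | yes wide = rotate (rotate T) , placement-wide (rotate (rotate T)) 3≤s 4s+3≤n wide
  ... | no ¬wide₂ | no ¬wide₀ | no ¬wide₁ =
    T , placement-narrow T 3≤s 4s+3≤n (≰+3⇒≤+2 ¬wide₀) (≰+3⇒≤+2 ¬wide₁) (≰+3⇒≤+2 ¬wide₂)

theorem5p4 : (n s : ℕ) .{{_ : NonZero n}} → 3 ≤ s → 4 * s + 3 ≤ n → gcd n s ≡ 1 →
             SpanningCyclable 3 (circ n s)
theorem5p4 n s 3≤s 4s+3≤n _ A ∣A∣≡3 =
  let (T , P) = placeable 3≤s 4s+3≤n (cyclicOrder A ∣A∣≡3) in separable-by-placement T 3≤s P
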